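{- The greedy algorithm has unbounded competitive ratio for the incremental versions of Knapsack, Weighted Independent Set and Disjoint Paths: for each of these three problems and every $\rho\ge1$ there is an instance on which the greedy incremental solution is not $\rho$-competitive.
   Context: For a finite ground set $\mathcal U$ and $f\colon2^{\mathcal U}\to\mathbb R_{\ge0}$, the greedy algorithm sets $\vec S_0=\emptyset$ and $\vec S_k=\vec S_{k-1}\cup\{s_k\}$ with $s_k\in\arg\max_{s\in\mathcal U\setminus\vec S_{k-1}}f(\vec S_{k-1}\cup\{s\})$; with $f^\star_k=\max\{f(S):|S|=k\}$, its output is $\rho$-competitive if $f^\star_k/f(\vec S_k)\le\rho$ for all $k\in\{1,\dots,|\mathcal U|\}$. Knapsack: a finite item set $X$ with sizes $s\colon X\to\mathbb R_{\ge0}$ and values $v\colon X\to\mathbb R_{\ge0}$, $\mathcal U=X$, and $f(S)$ is the largest $\sum_{x\in S'}v(x)$ over $S'\subseteq S$ with $\sum_{x\in S'}s(x)\le1$. Weighted Independent Set: a graph $G=(V,E)$ with vertex weights $w\colon V\to\mathbb R_{\ge0}$, $\mathcal U=V$, and $f(S)$ is the maximum weight of an independent set of $G$ contained in $S$. Disjoint Paths: a graph $G=(V,E)$, a set $\mathcal X\subseteq V^2$ of pairs with weights $w\colon\mathcal X\to\mathbb R_{\ge0}$, $\mathcal U=\mathcal X$, and $f(S)$ is the maximum weight of $S'\subseteq S$ such that $G$ contains mutually disjoint paths connecting the two vertices of each pair in $S'$ (the claim holds with disjointness read either as edge-disjointness or as vertex-disjointness).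
   Formalization: The parameter ρ ranges over the rationals with ρ ≥ 1, and the sizes, values and weights of the witnessing instances are taken in ℚ. -}

module Defs where

open import Data.Nat as ℕ using (ℕ; zero; suc; _<ᵇ_)
open import Data.Bool using (Bool; true; false; if_then_else_; _∧_)
open import Data.Fin using (Fin; toℕ; _≟_)
open import Data.Fin.Subset using (Subset; _∈_; _∉_; _⊆_; _∪_; ⁅_⁆; ∣_∣)
open import Data.Vec using (Vec; []; _∷_; tabulate)
open import Data.List using (List; []; _∷_; allFin)
open import Data.Bool.ListAction using (any)
open import Data.List.Membership.Propositional using () renaming (_∈_ to _∈ₗ_)
open import Data.List.Relation.Unary.Unique.Propositional using (Unique)
open import Data.Rational using (ℚ; 0ℚ; 1ℚ; _+_; _*_; _≤_; _<_)
open import Data.Product using (Σ; ∃; _×_; _,_; proj₁; proj₂)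
open import Data.Sum using (_⊎_)
open import Relation.Binary.PropositionalEquality using (_≡_; _≢_)
open import Relation.Nullary using (¬_)
open import Relation.Nullary.Decidable using (⌊_⌋)
open import Function using (_∘_; Injective)

-- Generic incremental problem on the ground set U = Fin n:
-- f(S) = max { weight w T | T ⊆ S, Feasible T }  (specified relationally)

weight : ∀ {n} → (Fin n → ℚ) → Subset n → ℚ
weight {zero}  w []      = 0ℚ
weight {suc n} w (b ∷ T) = (if b then w Fin.zero else 0ℚ) + weight (w ∘ Fin.suc) T
  where import Data.Fin as Fin

record Problem (n : ℕ) : Set₁ where
  field
    Feasible : Subset n → Set
    w        : Fin n → ℚ

module _ {n : ℕ} (P : Problem n) where
  open Problem P

  -- f(A) ≤ f(B), unfolded through the definition of f as a maximum
  _≼_ : Subset n → Subset n → Set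
  A ≼ B = ∀ T → T ⊆ A → Feasible T →
          ∃ λ T' → T' ⊆ B × Feasible T' × weight w T ≤ weight w T'

  -- ρ · f(B) < f(A)
  Exceeds : ℚ → Subset n → Subset n → Set
  Exceeds ρ A B = ∃ λ T → T ⊆ A × Feasible T ×
                    (∀ T' → T' ⊆ B → Feasible T' → ρ * weight w T' < weight w T)

-- A greedy run is an ordering σ of the ground set: σ k is the (k+1)-st pick.
-- prefix σ m = S_m = { σ j | j < m }.
prefix : ∀ {n} → (Fin n → Fin n) → ℕ → Subset n
prefix {n} σ m = tabulate λ i → any (λ j → (toℕ j <ᵇ m) ∧ ⌊ σ j ≟ i ⌋) (allFin n)

module _ {n : ℕ} (P : Problem n) where

  IsGreedy : (Fin n → Fin n) → Set
  IsGreedy σ = ∀ (k : Fin n) →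
      σ k ∉ prefix σ (toℕ k) ×
      (∀ s → s ∉ prefix σ (toℕ k) →
        _≼_ P (prefix σ (toℕ k) ∪ ⁅ s ⁆) (prefix σ (suc (toℕ k))))

  -- f*_k / f(S_k) > ρ for some k ∈ {1,…,n}, with f*_k = max_{|S| = k} f(S)
  NotCompetitive : ℚ → (Fin n → Fin n) → Set
  NotCompetitive ρ σ = ∃ λ (k : ℕ) → 1 ℕ.≤ k × k ℕ.≤ n ×
      ∃ λ (S : Subset n) → ∣ S ∣ ≡ k × Exceeds P ρ S (prefix σ k)

  GreedyFails : ℚ → Set
  GreedyFails ρ = ∀ σ → IsGreedy σ → NotCompetitive ρ σ

record KnapsackInstance : Set where
  field
    n       : ℕ
    size    : Fin n → ℚ
    value   : Fin n → ℚ
    size≥0  : ∀ x → 0ℚ ≤ size x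
    value≥0 : ∀ x → 0ℚ ≤ value x

knapsack : (I : KnapsackInstance) → Problem (KnapsackInstance.n I)
knapsack I = record
  { Feasible = λ T → weight size T ≤ 1ℚ
  ; w        = value }
  where open KnapsackInstance I

record Graph (m : ℕ) : Set where
  field
    adj     : Fin m → Fin m → Bool
    symm    : ∀ u v → adj u v ≡ adj v u
    irrefl  : ∀ u → adj u u ≡ false

record WISInstance : Set where
  field
    n     : ℕ
    G     : Graph n
    w     : Fin n → ℚ
    w≥0   : ∀ v → 0ℚ ≤ w v

wis : (I : WISInstance) → Problem (WISInstance.n I)
wis I = record
  { Feasible = λ T → ∀ u v → u ∈ T → v ∈ T → Graph.adj G u v ≡ false
  ; w        = w }
  where open WISInstance I

module _ {m : ℕ} (G : Graph m) where
  open Graph G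

  data Walk : Fin m → Fin m → Set where
    [_]    : ∀ u → Walk u u
    _∷⟨_⟩_ : ∀ u {x v} → adj u x ≡ true → Walk x v → Walk u v

  vertices : ∀ {u v} → Walk u v → List (Fin m)
  vertices [ u ]         = u ∷ []
  vertices (u ∷⟨ _ ⟩ p) = u ∷ vertices p

  edges : ∀ {u v} → Walk u v → List (Fin m × Fin m)
  edges [ u ]                  = []
  edges (_∷⟨_⟩_ u {x} _ p)    = (u , x) ∷ edges p

  record Path (u v : Fin m) : Set where
    field
      walk   : Walk u v
      simple : Unique (vertices walk)

data Disjointness : Set where
  vertexDisjoint edgeDisjoint : Disjointness

module _ {m : ℕ} {G : Graph m} where
  Disjoint : Disjointness → ∀ {a b c d} → Path G a b → Path G c d → Set
  Disjoint vertexDisjoint p q =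
    ∀ x → x ∈ₗ vertices G (Path.walk p) → ¬ (x ∈ₗ vertices G (Path.walk q))
  Disjoint edgeDisjoint p q =
    ∀ a b c d → (a , b) ∈ₗ edges G (Path.walk p) → (c , d) ∈ₗ edges G (Path.walk q) →
      ¬ ((a ≡ c × b ≡ d) ⊎ (a ≡ d × b ≡ c))

record DPInstance : Set where
  field
    m      : ℕ
    G      : Graph m
    n      : ℕ                       -- number of pairs, X = { pair i }
    pair   : Fin n → Fin m × Fin m
    pairInj : Injective _≡_ _≡_ pair
    w      : Fin n → ℚ
    w≥0    : ∀ i → 0ℚ ≤ w i

disjointPaths : Disjointness → (I : DPInstance) → Problem (DPInstance.n I)
disjointPaths mode I = record
  { Feasible = λ T →
      Σ (∀ i → i ∈ T → Path G (proj₁ (pair i)) (proj₂ (pair i))) λ P →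
        ∀ i j (i∈T : i ∈ T) (j∈T : j ∈ T) → i ≢ j → Disjoint mode (P i i∈T) (P j j∈T)
  ; w = w }
  where open DPInstance I

module Submission where

-- Given ρ ≤ N, take D = N and a large u, and 2D+2 elements: element 0 worth u+1, decoys 1, …, D
-- worth D, …, 1, and D+1 rivals worth u each.  Element 0 with the decoys is feasible, the rivals are
-- feasible, but no feasible set contains 0 together with a rival.  Greedy takes 0 first and is then
-- forced through the decoys in order, because a rival could only replace 0, trading u+1 for u.  After
-- D+1 steps greedy holds at most u+1+(D+1)D while the rivals hold (D+1)u, which is more than N times
-- as much once u > N(1+(N+1)N).  Knapsack (0 fills the knapsack, each rival takes 1/(D+1) of it,
-- decoys are free), independent set (0 is adjacent to every rival) and disjoint paths (0 must be
-- routed along a path through every rival's pair) all realise this pattern.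

open import Defs

-- Kept apart so that ℕ's _≤_, opened here, does not clash with ℚ's _≤_ in the statement below.
module GreedyTraps where

  open import Data.Bool using (Bool; true; false; if_then_else_; _∧_; _∨_; T)
  open import Data.Bool.Properties using (T-≡; T-∧; ∨-comm)
  open import Data.Empty using (⊥-elim)
  open import Data.Fin as Fin using (Fin; zero; suc; toℕ; inject₁; _≟_)
  import Data.Fin.Properties as Fin
  open import Data.Fin.Subset using (Subset; _∈_; _∉_; _⊆_; _∪_; _-_; ⁅_⁆; ∁; ∣_∣; ⊥)
  open import Data.Fin.Subset.Properties
    using (_∈?_; ⊆-antisym; drop-∷-⊆; x∈p∪q⁺; x∈p∪q⁻; x∈⁅x⁆; x∈⁅y⁆⇒x≡y; x∈∁p⇒x∉p;
           x∈p∧x≢y⇒x∈p-y; p─⊥≡p; p─q⊆p; ∣p─q∣≤∣p∣; ∣∁p∣≡n∸∣p∣)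
  import Data.Integer as ℤ
  import Data.Integer.Properties as ℤ
  open import Data.List using (allFin)
  open import Data.List.Membership.Propositional using (lose) renaming (_∈_ to _∈ₗ_)
  open import Data.List.Membership.Propositional.Properties using (∈-allFin)
  open import Data.List.Relation.Unary.All as All using (All; []; _∷_)
  open import Data.List.Relation.Unary.AllPairs using ([]; _∷_)
  open import Data.List.Relation.Unary.Any as Any using (satisfied)
  open import Data.List.Relation.Unary.Any.Properties using (any⁺; any⁻)
  open import Data.List.Relation.Unary.Unique.Propositional using (Unique)
  open import Data.Nat as ℕ using (ℕ; zero; suc; _+_; _*_; _∸_; _<ᵇ_; _≤_; _<_; z≤n; s≤s)
  import Data.Nat.Coprimality as Coprime
  import Data.Nat.Properties as ℕ
  open import Data.Nat.Solver using (module +-*-Solver)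
  open import Algebra.Properties.CommutativeSemigroup ℕ.+-commutativeSemigroup
    using (interchange; x∙yz≈y∙xz; xy∙z≈zx∙y)
  open import Data.Product using (∃; ∃₂; _×_; _,_; proj₁; proj₂)
  open import Data.Rational as ℚ using (ℚ; 0ℚ)
  import Data.Rational.Properties as ℚ
  import Data.Rational.Unnormalised as ℚᵘ
  import Data.Rational.Unnormalised.Properties as ℚᵘ
  open import Data.Sum using (_⊎_; inj₁; inj₂)
  open import Data.Vec using ([]; _∷_; here; there; tabulate)
  open import Data.Vec.Properties using (lookup∘tabulate; []=⇒lookup; lookup⇒[]=)
  open import Function using (_∘_; id; Equivalence)
  open import Relation.Binary.PropositionalEquality
    using (_≡_; _≢_; refl; sym; trans; cong; cong₂; subst; subst₂; module ≡-Reasoning)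
  open import Relation.Nullary using (¬_; Dec; yes; no; does)
  open import Relation.Nullary.Decidable using (⌊_⌋; toWitness; fromWitness; dec-true; dec-false)

  -- The embedding ℕ → ℚ

  ι : ℕ → ℚ
  ι n = ℚ.mkℚ (ℤ.+ n) 0 (Coprime.sym (Coprime.1-coprimeTo n))

  ι-homo-+ : ∀ m n → ι m ℚ.+ ι n ≡ ι (m + n)
  ι-homo-+ m n = ℚ.toℚᵘ-injective (ℚᵘ.≃-trans (ℚ.toℚᵘ-homo-+ (ι m) (ι n)) (ℚᵘ.*≡* eq))
    where
    open ≡-Reasoning
    eq : (ℤ.+ m ℤ.* ℤ.+ 1 ℤ.+ ℤ.+ n ℤ.* ℤ.+ 1) ℤ.* ℤ.+ 1 ≡ ℤ.+ (m + n) ℤ.* (ℤ.+ 1 ℤ.* ℤ.+ 1)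
    eq = begin
      (ℤ.+ m ℤ.* ℤ.+ 1 ℤ.+ ℤ.+ n ℤ.* ℤ.+ 1) ℤ.* ℤ.+ 1 ≡⟨ ℤ.*-identityʳ _ ⟩
      ℤ.+ m ℤ.* ℤ.+ 1 ℤ.+ ℤ.+ n ℤ.* ℤ.+ 1            ≡⟨ cong₂ ℤ._+_ (ℤ.*-identityʳ (ℤ.+ m)) (ℤ.*-identityʳ (ℤ.+ n)) ⟩
      ℤ.+ m ℤ.+ ℤ.+ n                                ≡⟨ ℤ.pos-+ m n ⟨
      ℤ.+ (m + n)                                    ≡⟨ ℤ.*-identityʳ _ ⟨
      ℤ.+ (m + n) ℤ.* (ℤ.+ 1 ℤ.* ℤ.+ 1)              ∎

  ι-homo-* : ∀ m n → ι m ℚ.* ι n ≡ ι (m * n)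
  ι-homo-* m n = ℚ.toℚᵘ-injective (ℚᵘ.≃-trans (ℚ.toℚᵘ-homo-* (ι m) (ι n)) (ℚᵘ.*≡* eq))
    where
    open ≡-Reasoning
    eq : (ℤ.+ m ℤ.* ℤ.+ n) ℤ.* ℤ.+ 1 ≡ ℤ.+ (m * n) ℤ.* (ℤ.+ 1 ℤ.* ℤ.+ 1)
    eq = begin
      (ℤ.+ m ℤ.* ℤ.+ n) ℤ.* ℤ.+ 1        ≡⟨ ℤ.*-identityʳ _ ⟩
      ℤ.+ m ℤ.* ℤ.+ n                    ≡⟨ ℤ.pos-* m n ⟨
      ℤ.+ (m * n)                        ≡⟨ ℤ.*-identityʳ _ ⟨
      ℤ.+ (m * n) ℤ.* (ℤ.+ 1 ℤ.* ℤ.+ 1)  ∎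

  ι-mono-≤ : ∀ {m n} → m ≤ n → ι m ℚ.≤ ι n
  ι-mono-≤ {m} {n} m≤n =
    ℚ.*≤* (subst₂ ℤ._≤_ (sym (ℤ.*-identityʳ (ℤ.+ m))) (sym (ℤ.*-identityʳ (ℤ.+ n))) (ℤ.+≤+ m≤n))

  ι-cancel-≤ : ∀ {m n} → ι m ℚ.≤ ι n → m ≤ n
  ι-cancel-≤ {m} {n} (ℚ.*≤* le) =
    ℤ.drop‿+≤+ (subst₂ ℤ._≤_ (ℤ.*-identityʳ (ℤ.+ m)) (ℤ.*-identityʳ (ℤ.+ n)) le)

  ι-mono-< : ∀ {m n} → m < n → ι m ℚ.< ι n
  ι-mono-< {m} {n} m<n =
    ℚ.*<* (subst₂ ℤ._<_ (sym (ℤ.*-identityʳ (ℤ.+ m))) (sym (ℤ.*-identityʳ (ℤ.+ n))) (ℤ.+<+ m<n))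

  ≤-ι∣numerator∣ : ∀ ρ → ρ ℚ.≤ ι ℤ.∣ ℚ.numerator ρ ∣
  ≤-ι∣numerator∣ (ℚ.mkℚ (ℤ.+ k) d _) = ℚ.*≤* (subst₂ ℤ._≤_
    (sym (ℤ.*-identityʳ (ℤ.+ k))) (ℤ.pos-* k (suc d)) (ℤ.+≤+ (ℕ.m≤m*n k (suc d))))
  ≤-ι∣numerator∣ (ℚ.mkℚ ℤ.-[1+ k ] d _) = ℚ.*≤* (subst₂ ℤ._≤_
    (sym (ℤ.*-identityʳ ℤ.-[1+ k ])) (ℤ.pos-* (suc k) (suc d)) ℤ.-≤+)

  -- Initial segments and greedy prefixes

  ∈-tabulate⁺ : ∀ {n} {f : Fin n → Bool} {i} → T (f i) → i ∈ tabulate f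
  ∈-tabulate⁺ {f = f} {i} t =
    lookup⇒[]= i (tabulate f) (trans (lookup∘tabulate f i) (Equivalence.to T-≡ t))

  ∈-tabulate⁻ : ∀ {n} {f : Fin n → Bool} {i} → i ∈ tabulate f → T (f i)
  ∈-tabulate⁻ {f = f} {i} i∈ =
    Equivalence.from T-≡ (trans (sym (lookup∘tabulate f i)) ([]=⇒lookup i∈))

  x∉p-x : ∀ {n} (p : Subset n) x → x ∉ p - x
  x∉p-x (_ ∷ _) zero ()
  x∉p-x (_ ∷ p) (suc x) (there x∈) = x∉p-x p x x∈

  x∈p-y⇒x≢y : ∀ {n} {p : Subset n} {x y} → x ∈ p - y → x ≢ y
  x∈p-y⇒x≢y {p = p} {y = y} x∈ refl = x∉p-x p y x∈

  ∪-monoˡ-⊆ : ∀ {n} {A B : Subset n} C → A ⊆ B → A ∪ C ⊆ B ∪ C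
  ∪-monoˡ-⊆ {A = A} C A⊆B i∈ with x∈p∪q⁻ A C i∈
  ... | inj₁ i∈A = x∈p∪q⁺ (inj₁ (A⊆B i∈A))
  ... | inj₂ i∈C = x∈p∪q⁺ (inj₂ i∈C)

  ⊆-∪⁅⁆-drop : ∀ {n} {T A : Subset n} {s} → T ⊆ A ∪ ⁅ s ⁆ → s ∉ T → T ⊆ A
  ⊆-∪⁅⁆-drop {T = T} {A} {s} T⊆ s∉T i∈T with x∈p∪q⁻ A ⁅ s ⁆ (T⊆ i∈T)
  ... | inj₁ i∈A = i∈A
  ... | inj₂ i∈s = ⊥-elim (s∉T (subst (_∈ T) (x∈⁅y⁆⇒x≡y s i∈s) i∈T))

  lower : ∀ {n} → ℕ → Subset n
  lower {zero}  _       = []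
  lower {suc n} zero    = false ∷ lower zero
  lower {suc n} (suc m) = true ∷ lower m

  ∈-lower⁺ : ∀ {n m} {i : Fin n} → toℕ i < m → i ∈ lower m
  ∈-lower⁺ {i = zero}  (s≤s _)   = here
  ∈-lower⁺ {i = suc i} (s≤s i<m) = there (∈-lower⁺ i<m)

  lower-zero-empty : ∀ {n} (i : Fin n) → i ∉ lower zero
  lower-zero-empty zero    ()
  lower-zero-empty (suc i) (there i∈) = lower-zero-empty i i∈

  ∈-lower⁻ : ∀ {n m} {i : Fin n} → i ∈ lower m → toℕ i < m
  ∈-lower⁻ {m = zero}  {i}     i∈         = ⊥-elim (lower-zero-empty i i∈)
  ∈-lower⁻ {m = suc m} {zero}  here       = s≤s z≤n
  ∈-lower⁻ {m = suc m} {suc i} (there i∈) = s≤s (∈-lower⁻ i∈)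

  ∣lower∣ : ∀ {n m} → m ≤ n → ∣ lower {n} m ∣ ≡ m
  ∣lower∣ {zero}          z≤n       = refl
  ∣lower∣ {suc n} {zero}  _         = ∣lower∣ {n} z≤n
  ∣lower∣ {suc n} {suc m} (s≤s m≤n) = cong suc (∣lower∣ m≤n)

  ∈-prefix⁺ : ∀ {n m} (σ : Fin n → Fin n) {j} → toℕ j < m → σ j ∈ prefix σ m
  ∈-prefix⁺ {n} {m} σ {j} j<m = ∈-tabulate⁺ (any⁺ {xs = allFin n} picked
    (lose (∈-allFin j) (Equivalence.from T-∧ (ℕ.<⇒<ᵇ j<m , fromWitness refl))))
    where
    picked : Fin n → Bool
    picked k = (toℕ k <ᵇ m) ∧ ⌊ σ k ≟ σ j ⌋

  ∈-prefix⁻ : ∀ {n m} (σ : Fin n → Fin n) {i} → i ∈ prefix σ m → ∃ λ j → toℕ j < m × σ j ≡ i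
  ∈-prefix⁻ {n} {m} σ {i} i∈ =
    let j , t        = satisfied (any⁻ picked (allFin n) (∈-tabulate⁻ i∈))
        j<m , σj≡i   = Equivalence.to T-∧ t
    in j , ℕ.<ᵇ⇒< _ _ j<m , toWitness σj≡i
    where
    picked : Fin n → Bool
    picked k = (toℕ k <ᵇ m) ∧ ⌊ σ k ≟ i ⌋

  prefix-suc : ∀ {n} (σ : Fin n → Fin n) k → prefix σ (suc (toℕ k)) ≡ prefix σ (toℕ k) ∪ ⁅ σ k ⁆
  prefix-suc σ k = ⊆-antisym p⊆q q⊆p
    where
    p⊆q : prefix σ (suc (toℕ k)) ⊆ prefix σ (toℕ k) ∪ ⁅ σ k ⁆
    p⊆q i∈ with ∈-prefix⁻ σ i∈
    ... | j , j<1+k , refl with ℕ.m≤n⇒m<n∨m≡n (ℕ.s≤s⁻¹ j<1+k)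
    ...   | inj₁ j<k = x∈p∪q⁺ (inj₁ (∈-prefix⁺ σ j<k))
    ...   | inj₂ j≡k rewrite Fin.toℕ-injective j≡k = x∈p∪q⁺ (inj₂ (x∈⁅x⁆ (σ k)))
    q⊆p : prefix σ (toℕ k) ∪ ⁅ σ k ⁆ ⊆ prefix σ (suc (toℕ k))
    q⊆p i∈ with x∈p∪q⁻ _ _ i∈
    ... | inj₂ i∈⁅σk⁆ rewrite x∈⁅y⁆⇒x≡y _ i∈⁅σk⁆ = ∈-prefix⁺ σ (ℕ.n<1+n (toℕ k))
    ... | inj₁ i∈p with ∈-prefix⁻ σ i∈p
    ...   | j , j<k , refl = ∈-prefix⁺ σ (ℕ.m<n⇒m<1+n j<k)

  prefix-lower : ∀ {n m} (σ : Fin n → Fin n) → (∀ i → toℕ i < m → σ i ≡ i) → prefix σ m ≡ lower m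
  prefix-lower {m = m} σ fixed = ⊆-antisym p⊆l l⊆p
    where
    p⊆l : prefix σ m ⊆ lower m
    p⊆l i∈ with ∈-prefix⁻ σ i∈
    ... | j , j<m , refl rewrite fixed j j<m = ∈-lower⁺ j<m
    l⊆p : lower m ⊆ prefix σ m
    l⊆p {i} i∈ = subst (_∈ prefix σ m) (fixed i (∈-lower⁻ i∈)) (∈-prefix⁺ σ (∈-lower⁻ i∈))

  lower-⊆-suc : ∀ {n m} → lower {n} m ⊆ lower (suc m)
  lower-⊆-suc = ∈-lower⁺ ∘ ℕ.m<n⇒m<1+n ∘ ∈-lower⁻

  lower-suc : ∀ {n} (x : Fin n) → lower (suc (toℕ x)) ≡ lower (toℕ x) ∪ ⁅ x ⁆
  lower-suc x = begin
    lower (suc (toℕ x))       ≡⟨ prefix-lower id (λ _ _ → refl) ⟨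
    prefix id (suc (toℕ x))   ≡⟨ prefix-suc id x ⟩
    prefix id (toℕ x) ∪ ⁅ x ⁆ ≡⟨ cong (_∪ ⁅ x ⁆) (prefix-lower id (λ _ _ → refl)) ⟩
    lower (toℕ x) ∪ ⁅ x ⁆     ∎
    where open ≡-Reasoning

  -- Weights of subsets

  weightℕ : ∀ {n} → (Fin n → ℕ) → Subset n → ℕ
  weightℕ v []      = 0
  weightℕ v (b ∷ T) = (if b then v zero else 0) + weightℕ (v ∘ suc) T

  weight-ι : ∀ {n} (v : Fin n → ℕ) T → weight (ι ∘ v) T ≡ ι (weightℕ v T)
  weight-ι v []          = refl
  weight-ι v (true ∷ T)  =
    trans (cong (ι (v zero) ℚ.+_) (weight-ι (v ∘ suc) T)) (ι-homo-+ (v zero) (weightℕ (v ∘ suc) T))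
  weight-ι v (false ∷ T) =
    trans (cong (ι 0 ℚ.+_) (weight-ι (v ∘ suc) T)) (ι-homo-+ 0 (weightℕ (v ∘ suc) T))

  weight-*ʳ : ∀ {n} (f : Fin n → ℚ) q T → weight (λ i → f i ℚ.* q) T ≡ weight f T ℚ.* q
  weight-*ʳ f q []          = sym (ℚ.*-zeroˡ q)
  weight-*ʳ f q (true ∷ T)  = trans (cong (f zero ℚ.* q ℚ.+_) (weight-*ʳ (f ∘ suc) q T))
                                    (sym (ℚ.*-distribʳ-+ q (f zero) (weight (f ∘ suc) T)))
  weight-*ʳ f q (false ∷ T) = trans (cong₂ ℚ._+_ (sym (ℚ.*-zeroˡ q)) (weight-*ʳ (f ∘ suc) q T))
                                    (sym (ℚ.*-distribʳ-+ q 0ℚ (weight (f ∘ suc) T)))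

  weightℕ-⊥ : ∀ {n} (v : Fin n → ℕ) → weightℕ v ⊥ ≡ 0
  weightℕ-⊥ {zero}  v = refl
  weightℕ-⊥ {suc n} v = weightℕ-⊥ (v ∘ suc)

  weightℕ-⁅⁆ : ∀ {n} (v : Fin n → ℕ) x → weightℕ v ⁅ x ⁆ ≡ v x
  weightℕ-⁅⁆ v zero    = trans (cong (v zero +_) (weightℕ-⊥ (v ∘ suc))) (ℕ.+-identityʳ _)
  weightℕ-⁅⁆ v (suc x) = weightℕ-⁅⁆ (v ∘ suc) x

  weightℕ-mono : ∀ {n} (v : Fin n → ℕ) {T A} → T ⊆ A → weightℕ v T ≤ weightℕ v A
  weightℕ-mono v {[]}        {[]}    _   = z≤n
  weightℕ-mono v {false ∷ T} {a ∷ A} T⊆A =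
    ℕ.+-mono-≤ z≤n (weightℕ-mono (v ∘ suc) (drop-∷-⊆ T⊆A))
  weightℕ-mono v {true ∷ T}  {a ∷ A} T⊆A with T⊆A here
  ... | here = ℕ.+-monoʳ-≤ (v zero) (weightℕ-mono (v ∘ suc) (drop-∷-⊆ T⊆A))

  weightℕ-∪ : ∀ {n} (v : Fin n → ℕ) A B → weightℕ v (A ∪ B) ≤ weightℕ v A + weightℕ v B
  weightℕ-∪ v []      []      = z≤n
  weightℕ-∪ v (a ∷ A) (b ∷ B) = ℕ.≤-trans
    (ℕ.+-mono-≤ (if-∨ a b) (weightℕ-∪ (v ∘ suc) A B))
    (ℕ.≤-reflexive (interchange (if a then v zero else 0) (if b then v zero else 0) _ _))
    where
    if-∨ : ∀ a b → (if a ∨ b then v zero else 0) ≤ (if a then v zero else 0) + (if b then v zero else 0)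
    if-∨ true  _     = ℕ.m≤m+n (v zero) _
    if-∨ false true  = ℕ.≤-refl
    if-∨ false false = z≤n

  weightℕ-remove : ∀ {n} (v : Fin n → ℕ) {x A} → x ∈ A → weightℕ v A ≡ v x + weightℕ v (A - x)
  weightℕ-remove v {zero}  {true ∷ A} here =
    cong (λ B → v zero + weightℕ (v ∘ suc) B) (sym (p─⊥≡p A))
  weightℕ-remove v {suc x} {a ∷ A} (there x∈A) =
    trans (cong (head +_) (weightℕ-remove (v ∘ suc) x∈A)) (x∙yz≈y∙xz head (v (suc x)) _)
    where
    head : ℕ
    head = if a then v zero else 0

  weightℕ-≤-card : ∀ {n} (v : Fin n → ℕ) {c} T → (∀ {i} → i ∈ T → v i ≤ c) → weightℕ v T ≤ ∣ T ∣ * c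
  weightℕ-≤-card v []          _  = z≤n
  weightℕ-≤-card v (true ∷ T)  ≤c = ℕ.+-mono-≤ (≤c here) (weightℕ-≤-card (v ∘ suc) T (≤c ∘ there))
  weightℕ-≤-card v (false ∷ T) ≤c = weightℕ-≤-card (v ∘ suc) T (≤c ∘ there)

  weightℕ-card : ∀ {n} (v : Fin n → ℕ) {c} T → (∀ {i} → i ∈ T → v i ≡ c) → weightℕ v T ≡ ∣ T ∣ * c
  weightℕ-card v []          _  = refl
  weightℕ-card v (true ∷ T)  ≡c = cong₂ _+_ (≡c here) (weightℕ-card (v ∘ suc) T (≡c ∘ there))
  weightℕ-card v (false ∷ T) ≡c = weightℕ-card (v ∘ suc) T (≡c ∘ there)

  module _ {n} (v : Fin n → ℕ) where
    open ℕ.≤-Reasoning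

    weightℕ-⊆-∪⁅⁆ : ∀ {T A s} → T ⊆ A ∪ ⁅ s ⁆ → weightℕ v T ≤ weightℕ v A + v s
    weightℕ-⊆-∪⁅⁆ {T} {A} {s} T⊆ = begin
      weightℕ v T                   ≤⟨ weightℕ-mono v T⊆ ⟩
      weightℕ v (A ∪ ⁅ s ⁆)         ≤⟨ weightℕ-∪ v A ⁅ s ⁆ ⟩
      weightℕ v A + weightℕ v ⁅ s ⁆ ≡⟨ cong (weightℕ v A +_) (weightℕ-⁅⁆ v s) ⟩
      weightℕ v A + v s             ∎

    weightℕ-insert : ∀ {A B x} → A ⊆ B → x ∉ A → x ∈ B → weightℕ v A + v x ≤ weightℕ v B
    weightℕ-insert {A} {B} {x} A⊆B x∉A x∈B = begin
      weightℕ v A + v x       ≤⟨ ℕ.+-monoˡ-≤ (v x) (weightℕ-mono v A⊆B-x) ⟩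
      weightℕ v (B - x) + v x ≡⟨ ℕ.+-comm _ (v x) ⟩
      v x + weightℕ v (B - x) ≡⟨ weightℕ-remove v x∈B ⟨
      weightℕ v B             ∎
      where
      A⊆B-x : A ⊆ B - x
      A⊆B-x i∈A = x∈p∧x≢y⇒x∈p-y (A⊆B i∈A) λ { refl → x∉A i∈A }

    weightℕ-exchange : ∀ {T A z s} → z ∈ A → z ∉ T → T ⊆ A ∪ ⁅ s ⁆ →
                       weightℕ v T + v z ≤ weightℕ v A + v s
    weightℕ-exchange {T} {A} {z} {s} z∈A z∉T T⊆ = begin
      weightℕ v T + v z             ≤⟨ ℕ.+-monoˡ-≤ (v z) (weightℕ-⊆-∪⁅⁆ T⊆A-z∪s) ⟩
      weightℕ v (A - z) + v s + v z ≡⟨ xy∙z≈zx∙y (weightℕ v (A - z)) (v s) (v z) ⟩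
      v z + weightℕ v (A - z) + v s ≡⟨ cong (_+ v s) (weightℕ-remove v z∈A) ⟨
      weightℕ v A + v s             ∎
      where
      T⊆A-z∪s : T ⊆ (A - z) ∪ ⁅ s ⁆
      T⊆A-z∪s i∈T with x∈p∪q⁻ A ⁅ s ⁆ (T⊆ i∈T)
      ... | inj₁ i∈A = x∈p∪q⁺ (inj₁ (x∈p∧x≢y⇒x∈p-y i∈A λ { refl → z∉T i∈T }))
      ... | inj₂ i∈s = x∈p∪q⁺ (inj₂ i∈s)

    weightℕ-lower-suc : ∀ x → weightℕ v (lower (toℕ x)) + v x ≤ weightℕ v (lower (suc (toℕ x)))
    weightℕ-lower-suc x = weightℕ-insert lower-⊆-suc
      (λ x∈ → ℕ.<-irrefl refl (∈-lower⁻ x∈)) (∈-lower⁺ (ℕ.n<1+n (toℕ x)))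

  -- The trap

  module Trap (D u : ℕ) (D≤u : D ≤ u) where

    size : ℕ
    size = suc (D + suc D)

    valueℕ : ℕ → ℕ
    valueℕ zero    = suc u
    valueℕ (suc k) = if does (D ℕ.<? suc k) then u else D ∸ k

    value : Fin size → ℕ
    value = valueℕ ∘ toℕ

    valueℕ-rival : ∀ {k} → D < k → valueℕ k ≡ u
    valueℕ-rival {suc k} D<k = cong (λ b → if b then u else D ∸ k) (dec-true (D ℕ.<? suc k) D<k)

    valueℕ-decoy : ∀ {k} → k < D → valueℕ (suc k) ≡ D ∸ k
    valueℕ-decoy {k} k<D =
      cong (λ b → if b then u else D ∸ k) (dec-false (D ℕ.<? suc k) (ℕ.<⇒≱ k<D ∘ ℕ.s≤s⁻¹))

    valueℕ-decoy-≤ : ∀ {k} → k < D → valueℕ (suc k) ≤ D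
    valueℕ-decoy-≤ {k} k<D rewrite valueℕ-decoy k<D = ℕ.m∸n≤m D k

    valueℕ-positive : ∀ {k} → k ≤ D → 0 < valueℕ k
    valueℕ-positive {zero}  _   = s≤s z≤n
    valueℕ-positive {suc k} k<D rewrite valueℕ-decoy k<D = ℕ.m<n⇒0<n∸m k<D

    valueℕ-decreasing : ∀ {j k} → j < k → k ≤ D → valueℕ k < valueℕ j
    valueℕ-decreasing {zero}  {suc k} _ k<D = s≤s (ℕ.≤-trans (valueℕ-decoy-≤ k<D) D≤u)
    valueℕ-decreasing {suc j} {suc k} (s≤s j<k) k<D
      rewrite valueℕ-decoy k<D | valueℕ-decoy (ℕ.<-trans j<k k<D) = ℕ.∸-monoʳ-< j<k (ℕ.<⇒≤ k<D)

    picks : Subset size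
    picks = lower (suc D)

    rivals : Subset size
    rivals = ∁ picks

    ∈-rivals⁻ : ∀ {i} → i ∈ rivals → D < toℕ i
    ∈-rivals⁻ i∈ = ℕ.≰⇒> (x∈∁p⇒x∉p i∈ ∘ ∈-lower⁺ ∘ s≤s)

    ∣picks∣ : ∣ picks ∣ ≡ suc D
    ∣picks∣ = ∣lower∣ (s≤s (ℕ.m≤m+n D (suc D)))

    ∣rivals∣ : ∣ rivals ∣ ≡ suc D
    ∣rivals∣ = trans (∣∁p∣≡n∸∣p∣ picks) (trans (cong (size ∸_) ∣picks∣) (ℕ.m+n∸m≡n D (suc D)))

    on-decoys : ∀ (P : ℕ → Set) {j} → j ≤ D → (∀ {k} → k < D → P (suc k)) →
                ∀ {i} → i ∈ lower {size} (suc j) - zero → P (toℕ i)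
    on-decoys P j≤D p {zero}  i∈ = ⊥-elim (x∈p-y⇒x≢y {p = lower (suc _)} i∈ refl)
    on-decoys P j≤D p {suc i} i∈ =
      p (ℕ.<-≤-trans (ℕ.s≤s⁻¹ (∈-lower⁻ (p─q⊆p (lower (suc _)) ⁅ zero ⁆ i∈))) j≤D)

    picks-weight : weightℕ value picks ≤ suc u + suc D * D
    picks-weight = begin
      weightℕ value picks                  ≡⟨ weightℕ-remove value (∈-lower⁺ {i = zero} (s≤s z≤n)) ⟩
      suc u + weightℕ value (picks - zero) ≤⟨ ℕ.+-monoʳ-≤ (suc u) (weightℕ-≤-card value (picks - zero)
                                                (on-decoys (λ k → valueℕ k ≤ D) ℕ.≤-refl valueℕ-decoy-≤)) ⟩
      suc u + ∣ picks - zero ∣ * D          ≤⟨ ℕ.+-monoʳ-≤ (suc u) (ℕ.*-monoˡ-≤ D (∣p─q∣≤∣p∣ picks ⁅ zero ⁆)) ⟩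
      suc u + ∣ picks ∣ * D                 ≡⟨ cong (λ c → suc u + c * D) ∣picks∣ ⟩
      suc u + suc D * D                     ∎
      where open ℕ.≤-Reasoning

    rivals-weight : weightℕ value rivals ≡ suc D * u
    rivals-weight = trans (weightℕ-card value rivals (valueℕ-rival ∘ ∈-rivals⁻)) (cong (_* u) ∣rivals∣)

    problem : (Subset size → Set) → Problem size
    problem F = record { Feasible = F ; w = ι ∘ value }

    record IsTrap (F : Subset size → Set) : Set where
      field
        prefixes-feasible    : ∀ {j} → j ≤ D → F (lower (suc j))
        zero-excludes-rivals : ∀ {T s} → F T → zero ∈ T → D < toℕ s → s ∉ T
        rivals-feasible      : F rivals

    module _ {F : Subset size → Set} (trap : IsTrap F) where
      open IsTrap trap

      next-strictly-best : ∀ {x s T} → toℕ x ≤ D → toℕ x < toℕ s → F T → T ⊆ lower (toℕ x) ∪ ⁅ s ⁆ →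
                           weightℕ value T < weightℕ value (lower (suc (toℕ x)))
      -- A decoy s is worth less than x; a rival s forces T to give up 0, trading u+1 for u.
      next-strictly-best {x} {s} {T} x≤D x<s FT T⊆ with toℕ s ℕ.≤? D | zero ∈? T
      ... | yes s≤D | _ = begin-strict
        weightℕ value T                           ≤⟨ weightℕ-⊆-∪⁅⁆ value T⊆ ⟩
        weightℕ value (lower (toℕ x)) + value s   <⟨ ℕ.+-monoʳ-< _ (valueℕ-decreasing x<s s≤D) ⟩
        weightℕ value (lower (toℕ x)) + value x   ≤⟨ weightℕ-lower-suc value x ⟩
        weightℕ value (lower (suc (toℕ x)))       ∎
        where open ℕ.≤-Reasoning
      ... | no s≰D | yes 0∈T = begin-strict
        weightℕ value T                           ≤⟨ weightℕ-mono value (⊆-∪⁅⁆-drop T⊆ s∉T) ⟩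
        weightℕ value (lower (toℕ x))             <⟨ ℕ.m<m+n _ (valueℕ-positive x≤D) ⟩
        weightℕ value (lower (toℕ x)) + value x   ≤⟨ weightℕ-lower-suc value x ⟩
        weightℕ value (lower (suc (toℕ x)))       ∎
        where
        open ℕ.≤-Reasoning
        s∉T : s ∉ T
        s∉T = zero-excludes-rivals FT 0∈T (ℕ.≰⇒> s≰D)
      ... | no s≰D | no 0∉T = ℕ.+-cancelʳ-≤ u _ _ (begin
        suc (weightℕ value T) + u      ≡⟨ ℕ.+-suc (weightℕ value T) u ⟨
        weightℕ value T + value zero   ≤⟨ weightℕ-exchange value (∈-lower⁺ (s≤s z≤n)) 0∉T T⊆next∪s ⟩
        weightℕ value next + value s   ≡⟨ cong (weightℕ value next +_) (valueℕ-rival (ℕ.≰⇒> s≰D)) ⟩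
        weightℕ value next + u         ∎)
        where
        open ℕ.≤-Reasoning
        next : Subset size
        next = lower (suc (toℕ x))
        T⊆next∪s : T ⊆ next ∪ ⁅ s ⁆
        T⊆next∪s = ∪-monoˡ-⊆ ⁅ s ⁆ lower-⊆-suc ∘ T⊆

      keeps-up⇒next : ∀ {x s} → toℕ x ≤ D → toℕ x ≤ toℕ s →
                      _≼_ (problem F) (lower (suc (toℕ x))) (lower (toℕ x) ∪ ⁅ s ⁆) → s ≡ x
      keeps-up⇒next {x} {s} x≤D x≤s keeps-up with s ≟ x
      ... | yes s≡x = s≡x
      ... | no s≢x =
        let T , T⊆ , FT , w≤ = keeps-up (lower (suc (toℕ x))) id (prefixes-feasible x≤D)
        in ⊥-elim (ℕ.<⇒≱ (next-strictly-best x≤D x<s FT T⊆)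
             (ι-cancel-≤ (subst₂ ℚ._≤_ (weight-ι value (lower (suc (toℕ x)))) (weight-ι value T) w≤)))
        where
        x<s : toℕ x < toℕ s
        x<s = ℕ.≤∧≢⇒< x≤s (s≢x ∘ sym ∘ Fin.toℕ-injective)

      module _ {σ} (greedy : IsGreedy (problem F) σ) where

        greedy-picks-next : ∀ x → toℕ x ≤ D → (∀ i → toℕ i < toℕ x → σ i ≡ i) → σ x ≡ x
        greedy-picks-next x x≤D fixed = keeps-up⇒next x≤D x≤σx
          (subst₂ (_≼_ (problem F)) next≡ chosen≡ (proj₂ (greedy x) x x∉prefix))
          where
          prefix≡ : prefix σ (toℕ x) ≡ lower (toℕ x)
          prefix≡ = prefix-lower σ fixed
          x∉prefix : x ∉ prefix σ (toℕ x)
          x∉prefix x∈ = ℕ.<-irrefl refl (∈-lower⁻ (subst (x ∈_) prefix≡ x∈))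
          x≤σx : toℕ x ≤ toℕ (σ x)
          x≤σx = ℕ.≮⇒≥ (proj₁ (greedy x) ∘ subst (σ x ∈_) (sym prefix≡) ∘ ∈-lower⁺)
          next≡ : prefix σ (toℕ x) ∪ ⁅ x ⁆ ≡ lower (suc (toℕ x))
          next≡ = trans (cong (_∪ ⁅ x ⁆) prefix≡) (sym (lower-suc x))
          chosen≡ : prefix σ (suc (toℕ x)) ≡ lower (toℕ x) ∪ ⁅ σ x ⁆
          chosen≡ = trans (prefix-suc σ x) (cong (_∪ ⁅ σ x ⁆) prefix≡)

        greedy-fixes : ∀ {j} → j ≤ suc D → ∀ i → toℕ i < j → σ i ≡ i
        greedy-fixes {suc j} (s≤s j≤D) i i<1+j with ℕ.m≤n⇒m<n∨m≡n (ℕ.s≤s⁻¹ i<1+j)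
        ... | inj₁ i<j  = greedy-fixes {j} (ℕ.m≤n⇒m≤1+n j≤D) i i<j
        ... | inj₂ refl = greedy-picks-next i j≤D (greedy-fixes {j} (ℕ.m≤n⇒m≤1+n j≤D))

        greedy-takes-picks : prefix σ (suc D) ≡ picks
        greedy-takes-picks = prefix-lower σ (greedy-fixes ℕ.≤-refl)

      greedyFails : ∀ {ρ N} → ρ ℚ.≤ ι N → N * (suc u + suc D * D) < suc D * u → GreedyFails (problem F) ρ
      greedyFails {ρ} {N} ρ≤N gap σ greedy =
        suc D , s≤s z≤n , s≤s (ℕ.m≤m+n D (suc D)) ,
        rivals , ∣rivals∣ , rivals , id , rivals-feasible , outweighed
        where
        outweighed : ∀ T → T ⊆ prefix σ (suc D) → F T →
                     ρ ℚ.* weight (ι ∘ value) T ℚ.< weight (ι ∘ value) rivals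
        outweighed T T⊆ _ = begin-strict
          ρ ℚ.* weight (ι ∘ value) T    ≡⟨ cong (ρ ℚ.*_) (weight-ι value T) ⟩
          ρ ℚ.* ι (weightℕ value T)     ≤⟨ ℚ.*-monoʳ-≤-nonNeg (ι (weightℕ value T)) ρ≤N ⟩
          ι N ℚ.* ι (weightℕ value T)   ≡⟨ ι-homo-* N (weightℕ value T) ⟩
          ι (N * weightℕ value T)       <⟨ ι-mono-< (ℕ.≤-<-trans (ℕ.*-monoʳ-≤ N greedy-bound) gap) ⟩
          ι (suc D * u)                 ≡⟨ cong ι rivals-weight ⟨
          ι (weightℕ value rivals)      ≡⟨ weight-ι value rivals ⟨
          weight (ι ∘ value) rivals     ∎
          where
          open ℚ.≤-Reasoning
          greedy-bound : weightℕ value T ≤ suc u + suc D * D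
          greedy-bound = ℕ.≤-trans
            (weightℕ-mono value (subst (T ⊆_) (greedy-takes-picks greedy) T⊆)) picks-weight

  -- Knapsack and weighted independent set

  module KnapsackTrap (D u : ℕ) (D≤u : D ≤ u) where
    open Trap D u D≤u

    loadℕ : ℕ → ℕ
    loadℕ zero    = suc D
    loadℕ (suc k) = if does (D ℕ.<? suc k) then 1 else 0

    load : Fin size → ℕ
    load = loadℕ ∘ toℕ

    loadℕ-rival : ∀ {k} → D < k → loadℕ k ≡ 1
    loadℕ-rival {suc k} D<k = cong (λ b → if b then 1 else 0) (dec-true (D ℕ.<? suc k) D<k)

    loadℕ-decoy : ∀ {k} → k < D → loadℕ (suc k) ≡ 0
    loadℕ-decoy {k} k<D = cong (λ b → if b then 1 else 0) (dec-false (D ℕ.<? suc k) (ℕ.<⇒≱ k<D ∘ ℕ.s≤s⁻¹))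

    unit : ℚ
    unit = ℚ.1/ ι (suc D)

    itemSize : Fin size → ℚ
    itemSize i = ι (load i) ℚ.* unit

    instanceOf : KnapsackInstance
    instanceOf = record
      { n       = size
      ; size    = itemSize
      ; value   = ι ∘ value
      ; size≥0  = λ i → subst (ℚ._≤ itemSize i) (ℚ.*-zeroˡ unit)
                              (ℚ.*-monoʳ-≤-nonNeg unit (ι-mono-≤ {0} {load i} z≤n))
      ; value≥0 = λ _ → ι-mono-≤ z≤n
      }

    Fits : Subset size → Set
    Fits = Problem.Feasible (knapsack instanceOf)

    size-weight : ∀ T → weight itemSize T ≡ ι (weightℕ load T) ℚ.* unit
    size-weight T = trans (weight-*ʳ (ι ∘ load) unit T) (cong (ℚ._* unit) (weight-ι load T))

    fits⁺ : ∀ T → weightℕ load T ≤ suc D → Fits T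
    fits⁺ T ≤D = subst₂ ℚ._≤_ (sym (size-weight T)) (ℚ.*-inverseʳ (ι (suc D)))
                        (ℚ.*-monoʳ-≤-nonNeg unit (ι-mono-≤ ≤D))

    fits⁻ : ∀ T → Fits T → weightℕ load T ≤ suc D
    fits⁻ T fits = ι-cancel-≤ (ℚ.*-cancelʳ-≤-pos unit
      (subst₂ ℚ._≤_ (size-weight T) (sym (ℚ.*-inverseʳ (ι (suc D)))) fits))

    prefix-load : ∀ {j} → j ≤ D → weightℕ load (lower (suc j)) ≡ suc D
    prefix-load {j} j≤D = begin
      weightℕ load L                  ≡⟨ weightℕ-remove load (∈-lower⁺ {i = zero} (s≤s z≤n)) ⟩
      suc D + weightℕ load (L - zero) ≡⟨ cong (suc D +_) (weightℕ-card load (L - zero)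
                                          (on-decoys (λ k → loadℕ k ≡ 0) j≤D loadℕ-decoy)) ⟩
      suc D + ∣ L - zero ∣ * 0        ≡⟨ cong (suc D +_) (ℕ.*-zeroʳ ∣ L - zero ∣) ⟩
      suc D + 0                       ≡⟨ ℕ.+-identityʳ (suc D) ⟩
      suc D                           ∎
      where
      open ≡-Reasoning
      L : Subset size
      L = lower (suc j)

    overload : ∀ {T s} → zero ∈ T → D < toℕ s → s ∈ T → suc D < weightℕ load T
    overload {T} {s} 0∈T D<s s∈T = begin-strict
      suc D                          <⟨ ℕ.m<m+n (suc D) (s≤s z≤n) ⟩
      suc D + 1                      ≡⟨ cong₂ _+_ (weightℕ-⁅⁆ load zero) (loadℕ-rival D<s) ⟨
      weightℕ load ⁅ zero ⁆ + load s ≤⟨ weightℕ-insert load ⁅0⁆⊆T s∉⁅0⁆ s∈T ⟩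
      weightℕ load T                 ∎
      where
      open ℕ.≤-Reasoning
      ⁅0⁆⊆T : ⁅ zero ⁆ ⊆ T
      ⁅0⁆⊆T i∈ = subst (_∈ T) (sym (x∈⁅y⁆⇒x≡y zero i∈)) 0∈T
      s∉⁅0⁆ : s ∉ ⁅ zero ⁆
      s∉⁅0⁆ s∈ = ℕ.<⇒≢ (ℕ.≤-<-trans z≤n D<s) (sym (cong toℕ (x∈⁅y⁆⇒x≡y zero s∈)))

    isTrap : IsTrap Fits
    isTrap = record
      { prefixes-feasible    = λ {j} j≤D → fits⁺ (lower (suc j)) (ℕ.≤-reflexive (prefix-load j≤D))
      ; zero-excludes-rivals = λ {T} fits 0∈T D<s s∈T → ℕ.<⇒≱ (overload 0∈T D<s s∈T) (fits⁻ T fits)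
      ; rivals-feasible      = fits⁺ rivals (ℕ.≤-reflexive rivals-load)
      }
      where
      rivals-load : weightℕ load rivals ≡ suc D
      rivals-load = trans (weightℕ-card load rivals (loadℕ-rival ∘ ∈-rivals⁻))
                          (trans (cong (_* 1) ∣rivals∣) (ℕ.*-identityʳ (suc D)))

  module IndependentSetTrap (D u : ℕ) (D≤u : D ≤ u) where
    open Trap D u D≤u

    rival? : Fin size → Bool
    rival? i = does (D ℕ.<? toℕ i)

    conflict : Fin size → Fin size → Bool
    conflict zero    j       = rival? j
    conflict (suc i) zero    = rival? (suc i)
    conflict (suc i) (suc j) = false

    graph : Graph size
    graph = record { adj = conflict ; symm = symm ; irrefl = irrefl }
      where
      symm : ∀ i j → conflict i j ≡ conflict j i
      symm zero    zero    = refl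
      symm zero    (suc j) = refl
      symm (suc i) zero    = refl
      symm (suc i) (suc j) = refl
      irrefl : ∀ i → conflict i i ≡ false
      irrefl zero    = refl
      irrefl (suc i) = refl

    instanceOf : WISInstance
    instanceOf = record { n = size ; G = graph ; w = ι ∘ value ; w≥0 = λ _ → ι-mono-≤ z≤n }

    Independent : Subset size → Set
    Independent = Problem.Feasible (wis instanceOf)

    rival?-true : ∀ {i} → D < toℕ i → rival? i ≡ true
    rival?-true {i} = dec-true (D ℕ.<? toℕ i)

    rival?-false : ∀ {i} → toℕ i ≤ D → rival? i ≡ false
    rival?-false {i} = dec-false (D ℕ.<? toℕ i) ∘ ℕ.≤⇒≯

    no-conflict-among-picks : ∀ {i j} → toℕ i ≤ D → toℕ j ≤ D → conflict i j ≡ false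
    no-conflict-among-picks {zero}  {zero}  _   _   = refl
    no-conflict-among-picks {zero}  {suc j} _   j≤D = rival?-false j≤D
    no-conflict-among-picks {suc i} {zero}  i≤D _   = rival?-false i≤D
    no-conflict-among-picks {suc i} {suc j} _   _   = refl

    no-conflict-among-rivals : ∀ {i j} → D < toℕ i → D < toℕ j → conflict i j ≡ false
    no-conflict-among-rivals {suc i} {suc j} _ _ = refl

    isTrap : IsTrap Independent
    isTrap = record
      { prefixes-feasible    = λ j≤D i j i∈ j∈ → no-conflict-among-picks (below j≤D i∈) (below j≤D j∈)
      ; zero-excludes-rivals = λ indep 0∈T D<s s∈T → true≢false
          (trans (sym (rival?-true D<s)) (indep zero _ 0∈T s∈T))
      ; rivals-feasible      = λ i j i∈ j∈ → no-conflict-among-rivals (∈-rivals⁻ i∈) (∈-rivals⁻ j∈)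
      }
      where
      below : ∀ {j i} → j ≤ D → i ∈ lower (suc j) → toℕ i ≤ D
      below j≤D i∈ = ℕ.≤-trans (ℕ.s≤s⁻¹ (∈-lower⁻ i∈)) j≤D
      true≢false : true ≢ false
      true≢false ()

  -- Walks and rank graphs

  module _ {m} (G : Graph m) where

    head∈vertices : ∀ {a b} (p : Walk G a b) → a ∈ₗ vertices G p
    head∈vertices [ a ]        = Any.here refl
    head∈vertices (a ∷⟨ _ ⟩ _) = Any.here refl

    source∈vertices : ∀ {a b c d} (p : Walk G a b) → (c , d) ∈ₗ edges G p → c ∈ₗ vertices G p
    source∈vertices (a ∷⟨ _ ⟩ p) (Any.here refl) = Any.here refl
    source∈vertices (a ∷⟨ _ ⟩ p) (Any.there e∈)  = Any.there (source∈vertices p e∈)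

    stay : ∀ {a b} → a ≡ b → Path G a b
    stay {a} refl = record { walk = [ a ] ; simple = [] ∷ [] }

    ∈-stay : ∀ {a b x} (a≡b : a ≡ b) → x ∈ₗ vertices G (Path.walk (stay a≡b)) → x ≡ a
    ∈-stay refl (Any.here x≡a) = x≡a

    ∉-edges-stay : ∀ {a b c d} (a≡b : a ≡ b) → ¬ (c , d) ∈ₗ edges G (Path.walk (stay a≡b))
    ∉-edges-stay refl ()

    hop : ∀ {a b c} → Graph.adj G a b ≡ true → a ≢ b → b ≡ c → Path G a c
    hop {a} {b} ab a≢b refl = record { walk = a ∷⟨ ab ⟩ [ b ] ; simple = (a≢b ∷ []) ∷ [] ∷ [] }

    ∈-edges-hop : ∀ {a b c x y} (ab : Graph.adj G a b ≡ true) (a≢b : a ≢ b) (b≡c : b ≡ c) →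
                  (x , y) ∈ₗ edges G (Path.walk (hop ab a≢b b≡c)) → x ≡ a × y ≡ b
    ∈-edges-hop ab a≢b refl (Any.here refl) = refl , refl

  module RankGraph {m} (rank : Fin m → ℕ) where

    adjacent : Fin m → Fin m → Bool
    adjacent a b = does (rank b ℕ.≟ suc (rank a)) ∨ does (rank a ℕ.≟ suc (rank b))

    graph : Graph m
    graph = record { adj = adjacent ; symm = symm ; irrefl = irrefl }
      where
      symm : ∀ a b → adjacent a b ≡ adjacent b a
      symm a b = ∨-comm (does (rank b ℕ.≟ suc (rank a))) (does (rank a ℕ.≟ suc (rank b)))
      irrefl : ∀ a → adjacent a a ≡ false
      irrefl a = cong (λ b → b ∨ b) (dec-false (rank a ℕ.≟ suc (rank a)) (ℕ.1+n≢n ∘ sym))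

    adjacent⁺ : ∀ {a b} → rank b ≡ suc (rank a) → adjacent a b ≡ true
    adjacent⁺ {a} {b} up = cong (_∨ does (rank a ℕ.≟ suc (rank b))) (dec-true (rank b ℕ.≟ suc (rank a)) up)

    adjacent⁻ : ∀ {a b} → adjacent a b ≡ true → rank b ≡ suc (rank a) ⊎ rank a ≡ suc (rank b)
    adjacent⁻ {a} {b} = either (rank b ℕ.≟ suc (rank a)) (rank a ℕ.≟ suc (rank b))
      where
      either : ∀ {P Q : Set} (p? : Dec P) (q? : Dec Q) → (does p? ∨ does q?) ≡ true → P ⊎ Q
      either (yes p) _       _ = inj₁ p
      either (no _)  (yes q) _ = inj₂ q
      either (no _)  (no _)  ()

    Crosses : ∀ {a b} → Walk graph a b → ℕ → Set
    Crosses p t = ∃₂ λ c d → (c , d) ∈ₗ edges graph p × rank c ≡ t × rank d ≡ suc t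

    crosses-∷ : ∀ {a x b t} (ax : adjacent a x ≡ true) (p : Walk graph x b) →
                Crosses p t → Crosses (a ∷⟨ ax ⟩ p) t
    crosses-∷ ax p (c , d , e∈ , rc , rd) = c , d , Any.there e∈ , rc , rd

    crossing : ∀ {a b t} (p : Walk graph a b) → rank a ≤ t → t < rank b → Crosses p t
    crossing [ a ] a≤t t<a = ⊥-elim (ℕ.<⇒≱ t<a a≤t)
    crossing {t = t} (_∷⟨_⟩_ a {x} ax p) a≤t t<b with adjacent⁻ ax
    ... | inj₂ a≡1+x = crosses-∷ ax p (crossing p (ℕ.<⇒≤ (ℕ.<-≤-trans (ℕ.≤-reflexive (sym a≡1+x)) a≤t)) t<b)
    ... | inj₁ x≡1+a with rank a ℕ.≟ t
    ...   | yes refl = a , x , Any.here refl , refl , x≡1+a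
    ...   | no a≢t   = crosses-∷ ax p (crossing p (subst (_≤ t) (sym x≡1+a) (ℕ.≤∧≢⇒< a≤t a≢t)) t<b)

    module Ascent (at : ℕ → Fin m) (L : ℕ) (rank-at : ∀ {k} → k ≤ L → rank (at k) ≡ k) where

      ascent : ∀ d t → d + t ≡ L → Walk graph (at t) (at L)
      ascent zero    t refl = [ at t ]
      ascent (suc d) t d+t≡L = at t ∷⟨ adjacent⁺ step ⟩ ascent d (suc t) (trans (ℕ.+-suc d t) d+t≡L)
        where
        t<L : t < L
        t<L = subst (t <_) d+t≡L (s≤s (ℕ.m≤n+m t d))
        step : rank (at (suc t)) ≡ suc (rank (at t))
        step = trans (rank-at t<L) (cong suc (sym (rank-at (ℕ.<⇒≤ t<L))))

      ascent-above : ∀ d t (e : d + t ≡ L) → All (λ y → t ≤ rank y) (vertices graph (ascent d t e))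
      ascent-above zero    t refl = ℕ.≤-reflexive (sym (rank-at ℕ.≤-refl)) ∷ []
      ascent-above (suc d) t e    =
        ℕ.≤-reflexive (sym (rank-at (ℕ.m+n≤o⇒n≤o (suc d) (ℕ.≤-reflexive e))))
        ∷ All.map ℕ.<⇒≤ (ascent-above d (suc t) (trans (ℕ.+-suc d t) e))

      ascent-unique : ∀ d t (e : d + t ≡ L) → Unique (vertices graph (ascent d t e))
      ascent-unique zero    t refl = [] ∷ []
      ascent-unique (suc d) t e    =
        All.map (λ t<y at≡y → ℕ.<-irrefl (trans (sym (rank-at t≤L)) (cong rank at≡y)) t<y)
                (ascent-above d (suc t) (trans (ℕ.+-suc d t) e))
        ∷ ascent-unique d (suc t) (trans (ℕ.+-suc d t) e)
        where
        t≤L : t ≤ L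
        t≤L = ℕ.m+n≤o⇒n≤o (suc d) (ℕ.≤-reflexive e)

      ∈-ascent : ∀ d t e {y} → y ∈ₗ vertices graph (ascent d t e) → y ≡ at t ⊎ t < rank y
      ∈-ascent zero    t refl (Any.here y≡) = inj₁ y≡
      ∈-ascent (suc d) t e    (Any.here y≡) = inj₁ y≡
      ∈-ascent (suc d) t e    (Any.there y∈) =
        inj₂ (All.lookup (ascent-above d (suc t) (trans (ℕ.+-suc d t) e)) y∈)

      ascentPath : Path graph (at 0) (at L)
      ascentPath = record { walk = ascent L 0 (ℕ.+-identityʳ L) ; simple = ascent-unique L 0 (ℕ.+-identityʳ L) }

  -- Disjoint paths

  module DisjointPathsTrap (D u : ℕ) (D≤u : D ≤ u) where
    open Trap D u D≤u

    -- Element i is routed from vertex i.  Under this rank the vertices 0, D+1, D+2, …, 2D+2 form a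
    -- path (the decoy vertices 1, …, D also have rank 0; only the decoys' own routes use them), which
    -- element 0 must traverse; a rival s sits on it at vertex s, or owns its edge s — s+1.
    rank : Fin (suc size) → ℕ
    rank x = toℕ x ∸ D

    open RankGraph rank

    L : ℕ
    L = suc (suc D)

    at : ℕ → Fin (suc size)
    at zero    = zero
    at (suc k) = Fin.fromℕ< (s≤s (ℕ.m⊓n≤n (suc (D + k)) size))

    rank-at : ∀ {k} → k ≤ L → rank (at k) ≡ k
    rank-at {zero}  _           = ℕ.0∸n≡0 D
    rank-at {suc k} (s≤s k≤1+D) = begin
      toℕ (at (suc k)) ∸ D      ≡⟨ cong (_∸ D) (Fin.toℕ-fromℕ< (s≤s (ℕ.m⊓n≤n (suc (D + k)) size))) ⟩
      suc (D + k) ℕ.⊓ size ∸ D  ≡⟨ cong (_∸ D) (ℕ.m≤n⇒m⊓n≡m (s≤s (ℕ.+-monoʳ-≤ D k≤1+D))) ⟩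
      suc (D + k) ∸ D           ≡⟨ cong (_∸ D) (ℕ.+-suc D k) ⟨
      D + suc k ∸ D             ≡⟨ ℕ.m+n∸m≡n D (suc k) ⟩
      suc k                     ∎
      where open ≡-Reasoning

    open Ascent at L rank-at

    rank-inject₁ : ∀ i → rank (inject₁ i) ≡ toℕ i ∸ D
    rank-inject₁ i = cong (_∸ D) (Fin.toℕ-inject₁ i)

    rank-injective : ∀ {x y} → 0 < rank x → rank x ≡ rank y → x ≡ y
    rank-injective {x} {y} 0<rx rx≡ry =
      Fin.toℕ-injective (ℕ.∸-cancelʳ-≡ (D≤ 0<rx) (D≤ (subst (0 <_) rx≡ry 0<rx)) rx≡ry)
      where
      D≤ : ∀ {z} → 0 < rank z → D ≤ toℕ z
      D≤ 0<rz = ℕ.<⇒≤ (ℕ.m∸n≢0⇒n<m (ℕ.>⇒≢ 0<rz))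

    endpoint : Disjointness → Fin size → Fin (suc size)
    endpoint _              zero    = at L
    endpoint vertexDisjoint (suc i) = inject₁ (suc i)
    endpoint edgeDisjoint   (suc i) = if does (D ℕ.<? suc (toℕ i)) then suc (suc i) else inject₁ (suc i)

    decoy-endpoint : ∀ mode {j} → j ≤ D → ∀ {i} → suc i ∈ lower (suc j) →
                     inject₁ (suc i) ≡ endpoint mode (suc i)
    decoy-endpoint vertexDisjoint j≤D     i∈ = refl
    decoy-endpoint edgeDisjoint   j≤D {i} i∈ = cong (λ b → if b then suc (suc i) else inject₁ (suc i))
      (sym (dec-false (D ℕ.<? suc (toℕ i)) (ℕ.≤⇒≯ (ℕ.≤-trans (ℕ.s≤s⁻¹ (∈-lower⁻ i∈)) j≤D))))

    rival-endpoint : ∀ {s} → D < toℕ s → endpoint edgeDisjoint s ≡ suc s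
    rival-endpoint {suc i} D<s = cong (λ b → if b then suc (suc i) else inject₁ (suc i))
                                      (dec-true (D ℕ.<? suc (toℕ i)) D<s)

    instanceOf : Disjointness → DPInstance
    instanceOf mode = record
      { m       = suc size
      ; G       = graph
      ; n       = size
      ; pair    = λ i → inject₁ i , endpoint mode i
      ; pairInj = Fin.inject₁-injective ∘ cong proj₁
      ; w       = ι ∘ value
      ; w≥0     = λ _ → ι-mono-≤ z≤n
      }

    Routable : Disjointness → Subset size → Set
    Routable mode = Problem.Feasible (disjointPaths mode (instanceOf mode))

    bigPath : Path graph zero (at L)
    bigPath = ascentPath

    bigPath-avoids-decoys : ∀ {j} → j ≤ D → ∀ {k} → suc k ∈ lower (suc j) →
                            ¬ inject₁ (suc k) ∈ₗ vertices graph (Path.walk bigPath)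
    bigPath-avoids-decoys j≤D {k} k∈ y∈ with ∈-ascent L 0 (ℕ.+-identityʳ L) y∈
    ... | inj₁ ()
    ... | inj₂ 0<rank = ℕ.<⇒≱ (ℕ.m∸n≢0⇒n<m (ℕ.>⇒≢ 0<rank))
      (subst (_≤ D) (sym (Fin.toℕ-inject₁ (suc k))) (ℕ.≤-trans (ℕ.s≤s⁻¹ (∈-lower⁻ k∈)) j≤D))

    prefixPaths : ∀ mode {j} → j ≤ D → ∀ i → i ∈ lower (suc j) → Path graph (inject₁ i) (endpoint mode i)
    prefixPaths mode j≤D zero    _  = bigPath
    prefixPaths mode j≤D (suc i) i∈ = stay graph (decoy-endpoint mode j≤D i∈)

    decoy-edgeless : ∀ mode {j} (j≤D : j ≤ D) {i} (i∈ : suc i ∈ lower (suc j)) {c d} →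
                     ¬ (c , d) ∈ₗ edges graph (Path.walk (prefixPaths mode j≤D (suc i) i∈))
    decoy-edgeless mode j≤D i∈ = ∉-edges-stay graph (decoy-endpoint mode j≤D i∈)

    rival-rank-positive : ∀ {s} → D < toℕ s → 0 < rank (inject₁ s)
    rival-rank-positive {s} D<s = subst (0 <_) (sym (rank-inject₁ s)) (ℕ.m<n⇒0<n∸m D<s)

    zero≢rival : ∀ {s : Fin size} → D < toℕ s → zero ≢ s
    zero≢rival D<s refl = ℕ.<⇒≱ D<s z≤n

    big-crosses : ∀ (p : Walk graph zero (at L)) {s} → D < toℕ s → Crosses p (rank (inject₁ s))
    big-crosses p {s} D<s = crossing p (subst (_≤ rank (inject₁ s)) (sym (ℕ.0∸n≡0 D)) z≤n)
      (subst (rank (inject₁ s) <_) (sym (rank-at ℕ.≤-refl)) (s≤s (begin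
        rank (inject₁ s)  ≡⟨ rank-inject₁ s ⟩
        toℕ s ∸ D         ≤⟨ ℕ.∸-monoˡ-≤ D (ℕ.s≤s⁻¹ (Fin.toℕ<n s)) ⟩
        D + suc D ∸ D     ≡⟨ ℕ.m+n∸m≡n D (suc D) ⟩
        suc D             ∎)))
      where open ℕ.≤-Reasoning

    vertexTrap : IsTrap (Routable vertexDisjoint)
    vertexTrap = record
      { prefixes-feasible    = λ j≤D → prefixPaths vertexDisjoint j≤D , apart j≤D
      ; zero-excludes-rivals = meet
      ; rivals-feasible      = rivalStay , rivals-apart
      }
      where
      stays-apart : ∀ {i k a b} (e₁ : inject₁ i ≡ a) (e₂ : inject₁ k ≡ b) → i ≢ k →
                    Disjoint vertexDisjoint (stay graph e₁) (stay graph e₂)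
      stays-apart e₁ e₂ i≢k x x∈i x∈k =
        i≢k (Fin.inject₁-injective (trans (sym (∈-stay graph e₁ x∈i)) (∈-stay graph e₂ x∈k)))

      apart : ∀ {j} (j≤D : j ≤ D) i k (i∈ : i ∈ lower (suc j)) (k∈ : k ∈ lower (suc j)) → i ≢ k →
              Disjoint vertexDisjoint (prefixPaths vertexDisjoint j≤D i i∈)
                                      (prefixPaths vertexDisjoint j≤D k k∈)
      apart j≤D zero    zero    _  _  0≢0 = ⊥-elim (0≢0 refl)
      apart j≤D zero    (suc k) _  k∈ _   x x∈big x∈k =
        bigPath-avoids-decoys j≤D k∈ (subst (_∈ₗ _) (∈-stay graph refl x∈k) x∈big)
      apart j≤D (suc i) zero    i∈ _  _   x x∈i x∈big =
        bigPath-avoids-decoys j≤D i∈ (subst (_∈ₗ _) (∈-stay graph refl x∈i) x∈big)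
      apart j≤D (suc i) (suc k) _  _  i≢k = stays-apart refl refl i≢k

      meet : ∀ {T s} → Routable vertexDisjoint T → zero ∈ T → D < toℕ s → s ∉ T
      meet {s = s} (P , disjoint) 0∈T D<s s∈T with big-crosses (Path.walk (P zero 0∈T)) D<s
      ... | c , _ , cd∈ , rc , _ =
        disjoint zero s 0∈T s∈T (zero≢rival D<s) c (source∈vertices graph _ cd∈)
          (subst (_∈ₗ vertices graph (Path.walk (P s s∈T)))
                 (sym (rank-injective (subst (0 <_) (sym rc) (rival-rank-positive D<s)) rc))
                 (head∈vertices graph _))

      rivalStay : ∀ s → s ∈ rivals → Path graph (inject₁ s) (endpoint vertexDisjoint s)
      rivalStay zero    0∈ = ⊥-elim (ℕ.<⇒≱ (∈-rivals⁻ 0∈) z≤n)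
      rivalStay (suc i) _  = stay graph refl

      rivals-apart : ∀ i k (i∈ : i ∈ rivals) (k∈ : k ∈ rivals) → i ≢ k →
                     Disjoint vertexDisjoint (rivalStay i i∈) (rivalStay k k∈)
      rivals-apart zero    _       0∈ _  = ⊥-elim (ℕ.<⇒≱ (∈-rivals⁻ 0∈) z≤n)
      rivals-apart (suc i) zero    _  0∈ = ⊥-elim (ℕ.<⇒≱ (∈-rivals⁻ 0∈) z≤n)
      rivals-apart (suc i) (suc k) _  _  = stays-apart refl refl

    rank-suc : ∀ {s : Fin size} → D ≤ toℕ s → rank (suc s) ≡ suc (rank (inject₁ s))
    rank-suc {s} D≤s = trans (ℕ.+-∸-assoc 1 D≤s) (cong suc (sym (rank-inject₁ s)))

    inject₁≢suc : ∀ (s : Fin size) → inject₁ s ≢ suc s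
    inject₁≢suc s e = ℕ.1+n≢n (sym (trans (sym (Fin.toℕ-inject₁ s)) (cong toℕ e)))

    rivalHop : ∀ {s} → D < toℕ s → Path graph (inject₁ s) (endpoint edgeDisjoint s)
    rivalHop {s} D<s =
      hop graph (adjacent⁺ (rank-suc (ℕ.<⇒≤ D<s))) (inject₁≢suc s) (sym (rival-endpoint D<s))

    ∈-edges-rivalHop : ∀ {s x y} (D<s : D < toℕ s) →
                       (x , y) ∈ₗ edges graph (Path.walk (rivalHop D<s)) → x ≡ inject₁ s × y ≡ suc s
    ∈-edges-rivalHop {s} D<s = ∈-edges-hop graph (adjacent⁺ (rank-suc (ℕ.<⇒≤ D<s))) (inject₁≢suc s)
                                                 (sym (rival-endpoint D<s))

    edgeTrap : IsTrap (Routable edgeDisjoint)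
    edgeTrap = record
      { prefixes-feasible    = λ j≤D → prefixPaths edgeDisjoint j≤D , apart j≤D
      ; zero-excludes-rivals = share
      ; rivals-feasible      = (λ s s∈ → rivalHop (∈-rivals⁻ s∈)) , rivals-apart
      }
      where
      apart : ∀ {j} (j≤D : j ≤ D) i k (i∈ : i ∈ lower (suc j)) (k∈ : k ∈ lower (suc j)) → i ≢ k →
              Disjoint edgeDisjoint (prefixPaths edgeDisjoint j≤D i i∈)
                                    (prefixPaths edgeDisjoint j≤D k k∈)
      apart j≤D zero    zero    _ _ 0≢0 = ⊥-elim (0≢0 refl)
      apart j≤D zero    (suc k) _ k∈ _  _ _ _ _ _   cd∈ _ = decoy-edgeless edgeDisjoint j≤D k∈ cd∈
      apart j≤D (suc i) _       i∈ _ _  _ _ _ _ ab∈ _   _ = decoy-edgeless edgeDisjoint j≤D i∈ ab∈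

      share : ∀ {T s} → Routable edgeDisjoint T → zero ∈ T → D < toℕ s → s ∉ T
      share {s = s} (P , disjoint) 0∈T D<s s∈T
        with big-crosses (Path.walk (P zero 0∈T)) D<s
           | crossing (Path.walk (P s s∈T)) ℕ.≤-refl
               (ℕ.≤-reflexive (sym (trans (cong rank (rival-endpoint D<s)) (rank-suc (ℕ.<⇒≤ D<s)))))
      ... | c , d , cd∈ , rc , rd | c′ , d′ , cd∈′ , rc′ , rd′ =
        disjoint zero s 0∈T s∈T (zero≢rival D<s) c d c′ d′ cd∈ cd∈′
          (inj₁ (rank-injective (subst (0 <_) (sym rc) (rival-rank-positive D<s)) (trans rc (sym rc′))
               , rank-injective (subst (0 <_) (sym rd) (s≤s z≤n)) (trans rd (sym rd′))))

      rivals-apart : ∀ i k (i∈ : i ∈ rivals) (k∈ : k ∈ rivals) → i ≢ k →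
                     Disjoint edgeDisjoint (rivalHop (∈-rivals⁻ i∈)) (rivalHop (∈-rivals⁻ k∈))
      rivals-apart i k i∈ k∈ i≢k a b c d ab∈ cd∈ same
        with ∈-edges-rivalHop (∈-rivals⁻ i∈) ab∈ | ∈-edges-rivalHop (∈-rivals⁻ k∈) cd∈ | same
      ... | refl , refl | refl , refl | inj₁ (i≡k , _) = i≢k (Fin.inject₁-injective i≡k)
      ... | refl , refl | refl , refl | inj₂ (i≡1+k , 1+i≡k) =
        ℕ.<-irrefl (trans i≡1+k′ (cong suc k≡1+i)) (ℕ.m<n⇒m<1+n (ℕ.n<1+n (toℕ i)))
        where
        i≡1+k′ : toℕ i ≡ suc (toℕ k)
        i≡1+k′ = trans (sym (Fin.toℕ-inject₁ i)) (cong toℕ i≡1+k)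
        k≡1+i : toℕ k ≡ suc (toℕ i)
        k≡1+i = trans (sym (Fin.toℕ-inject₁ k)) (cong toℕ (sym 1+i≡k))

    isTrap : ∀ mode → IsTrap (Routable mode)
    isTrap vertexDisjoint = vertexTrap
    isTrap edgeDisjoint   = edgeTrap

  -- Choice of parameters

  -- For D = N, (N+1)u > N(u+1+(N+1)N) exactly when u > N(1+(N+1)N).
  rivalValue : ℕ → ℕ
  rivalValue N = suc (N * suc (suc N * N))

  N≤rivalValue : ∀ N → N ≤ rivalValue N
  N≤rivalValue N = ℕ.m≤n⇒m≤1+n (ℕ.m≤m*n N (suc (suc N * N)))

  rivalValue-gap : ∀ N → N * (suc (rivalValue N) + suc N * N) < suc N * rivalValue N
  rivalValue-gap N = ℕ.≤-reflexive (solve 1 (λ n →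
      con 1 :+ n :* (con 1 :+ (con 1 :+ n :* (con 1 :+ (con 1 :+ n) :* n)) :+ (con 1 :+ n) :* n)
      := (con 1 :+ n) :* (con 1 :+ n :* (con 1 :+ (con 1 :+ n) :* n))) refl N)
    where open +-*-Solver

  module Unbounded (ρ : ℚ) where
    N : ℕ
    N = ℤ.∣ ℚ.numerator ρ ∣

    u : ℕ
    u = rivalValue N

    N≤u : N ≤ u
    N≤u = N≤rivalValue N

    open Trap N u N≤u

    fails : ∀ {F} → IsTrap F → GreedyFails (problem F) ρ
    fails trap = greedyFails trap (≤-ι∣numerator∣ ρ) (rivalValue-gap N)

  knapsack-greedyFails : ∀ ρ → ∃ λ I → GreedyFails (knapsack I) ρ
  knapsack-greedyFails ρ = instanceOf , fails isTrap
    where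
    open Unbounded ρ
    open KnapsackTrap N u N≤u

  independentSet-greedyFails : ∀ ρ → ∃ λ I → GreedyFails (wis I) ρ
  independentSet-greedyFails ρ = instanceOf , fails isTrap
    where
    open Unbounded ρ
    open IndependentSetTrap N u N≤u

  disjointPaths-greedyFails : ∀ mode ρ → ∃ λ I → GreedyFails (disjointPaths mode I) ρ
  disjointPaths-greedyFails mode ρ = instanceOf mode , fails (isTrap mode)
    where
    open Unbounded ρ
    open DisjointPathsTrap N u N≤u

open GreedyTraps using (knapsack-greedyFails; independentSet-greedyFails; disjointPaths-greedyFails)
open import Data.Rational using (ℚ; 1ℚ; _≤_)
open import Data.Product using (_×_; ∃; _,_)

mainTheorem8 :
    (∀ (ρ : ℚ) → 1ℚ ≤ ρ → ∃ λ (I : KnapsackInstance) → GreedyFails (knapsack I) ρ)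
    × (∀ (ρ : ℚ) → 1ℚ ≤ ρ → ∃ λ (I : WISInstance) → GreedyFails (wis I) ρ)
    × (∀ (mode : Disjointness) (ρ : ℚ) → 1ℚ ≤ ρ →
         ∃ λ (I : DPInstance) → GreedyFails (disjointPaths mode I) ρ)
-- The construction works for every ρ.
mainTheorem8 =
    (λ ρ _ → knapsack-greedyFails ρ)
  , (λ ρ _ → independentSet-greedyFails ρ)
  , (λ mode ρ _ → disjointPaths-greedyFails mode ρ)
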